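{- Let $S>1$ be square-free with $D_3(S)=1$ (no prime $p\equiv1\pmod3$ divides $S$). Define $\mathcal B(S)^\pm=\sum_{\widehat\sigma\in H_S^\pm}\prod_{p\mid S,\,p\ne3}B(\nu_p)$. If $\gcd(S,6)=1$, then $\mathcal B(S)^+=2^{\omega(S)-1}$ if some $p\mid S$ has $p\equiv5\pmod{12}$; $\mathcal B(S)^+=2^{\omega(S)}$ if $\omega(S)$ is even and $p\equiv11\pmod{12}$ for all $p\mid S$; $\mathcal B(S)^+=0$ if $\omega(S)$ is odd and $p\equiv11\pmod{12}$ for all $p\mid S$; and $\mathcal B(S)^-$ is given by the same formula with "even" and "odd" interchanged, i.e. $\mathcal B(S)^-=2^{\omega(S)}-\mathcal B(S)^+$. If $S$ is odd and $3\mid S$, then $\mathcal B(S)^\pm=\mathcal B(S/3)^\pm$ if $S>3$, and $\mathcal B(3)^+=1$, $\mathcal B(3)^-=0$. If $S$ is even, then $\mathcal B(S)^\pm=\mathcal B(S/2)^\mp$ if $S>2$, and $\mathcal B(2)^+=0$, $\mathcal B(2)^-=1$.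
   Context: For a prime $p$, a depth zero supercuspidal representation of $\mathrm{PGL}_2(\mathbf Q_p)$ is $\sigma_\nu=\operatorname{c-Ind}_{Z\mathrm{GL}_2(\mathbf Z_p)}^{\mathrm{GL}_2(\mathbf Q_p)}\rho_\nu$ (center acting trivially), where $\nu$ is a character of $\mathbf F_{p^2}^*$ with $\nu^p\ne\nu$ and $\nu|_{\mathbf F_p^*}=1$, and $\rho_\nu$ is the $(p-1)$-dimensional cuspidal representation of $\mathrm{GL}_2(\mathbf F_p)$ attached to $\nu$ (inflated); $\sigma_\nu\cong\sigma_{\nu'}$ iff $\nu'\in\{\nu,\nu^p\}$. These are the supercuspidals of conductor $p^2$ with trivial central character. $H_S^+$ (resp. $H_S^-$) is the set of tuples $\widehat\sigma=(\sigma_p)_{p\mid S}$ of such representations (one for each $p\mid S$, up to isomorphism) with $\prod_{p\mid S}\epsilon_p=1$ (resp. $-1$), where $\epsilon_p$ is the root number of $\sigma_p$; $\nu_p$ is the character attached to $\sigma_p$. For $p\equiv2\pmod3$, $B(\nu_p)=-2$ if the order of $\nu_p$ divides $\frac{p+1}3$ and $B(\nu_p)=1$ otherwise. $\omega(S)$ is the number of prime factors of $S$. -}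

module Defs where

open import Data.Nat using (ℕ; zero; suc; _+_; _*_; _∸_; _^_; _≤_; _<_; _≤?_)
open import Data.Nat.Properties using (_≟_)
open import Data.Nat.DivMod using (_/_; _%_)
open import Data.Nat.Divisibility using (_∣_; _∣?_)
open import Data.Nat.Primality using (Prime; prime?)
open import Data.Integer as ℤ using (ℤ; +_; -_)
open import Data.List using (List; []; _∷_; [_]; map; filter; upTo; foldr; concatMap; length)
open import Data.Product using (_×_; _,_)
open import Data.Bool using (if_then_else_)
open import Relation.Nullary using (¬_; does)
open import Relation.Nullary.Decidable using (_×-dec_; ¬?)

SquareFree : ℕ → Set
SquareFree n = ∀ p → Prime p → ¬ (p * p ∣ n)

D3≡1 : ℕ → Set
D3≡1 S = ∀ p → Prime p → p ∣ S → ¬ (p % 3 ≡ 1)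
  where open import Relation.Binary.PropositionalEquality using (_≡_)

primeFactors : ℕ → List ℕ
primeFactors S = filter (λ p → prime? p ×-dec p ∣? S) (upTo (suc S))

ω : ℕ → ℕ
ω S = length (primeFactors S)

-- Depth-zero supercuspidals of PGL₂(ℚ_p) of conductor p², modelled by
-- their characters ν.
--
-- A character ν of 𝔽_{p²}^* with ν|𝔽_p^* = 1 factors through the cyclic
-- group 𝔽_{p²}^*/𝔽_p^* of order p+1.  Fixing a generator g of that group
-- and a primitive (p+1)-th root of unity ζ, such ν are exactly
-- ν_k : g ↦ ζ^k,  k ∈ ℤ/(p+1), i.e. k ∈ {0,…,p}.
-- Since x^p = x⁻¹ in 𝔽_{p²}^*/𝔽_p^*, ν_k^p = ν_{-k}, and
--   ν^p ≠ ν  ⇔  ν^{p-1} ≠ 1  ⇔  ¬ (p+1 ∣ k(p-1)).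
-- σ_{ν_k} ≅ σ_{ν_{k'}} iff k' ∈ {k, -k}; as representative of the
-- isomorphism class we take the one with k ≤ (p+1) - k.

-- ν_k^m = 1  (i.e. ord(ν_k) ∣ m)  iff  p+1 ∣ k·m
ν-pow-trivial? : (p k m : ℕ) → _
ν-pow-trivial? p k m = suc p ∣? (k * m)

reps : ℕ → List ℕ
reps p = filter (λ k → ¬? (ν-pow-trivial? p k (p ∸ 1)) ×-dec (k ≤? (suc p ∸ k)))
                (upTo (suc p))

-- Value ν_k(δ) ∈ {±1}, where δ ∈ 𝔽_{p²}^* is any element with δ^{p-1} = -1.
-- The image of δ in 𝔽_{p²}^*/𝔽_p^* is g^{(p+1)/2} for p odd (δ ∉ 𝔽_p,
-- δ² ∈ 𝔽_p) and trivial for p = 2 (δ = 1); so ν_k(δ) = (-1)^k resp. 1.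
νδ : ℕ → ℕ → ℤ
νδ p k = if does (p ≟ 2) then + 1
         else (if does (k % 2 ≟ 0) then + 1 else - (+ 1))

rootNumber : ℕ → ℕ → ℤ
rootNumber p k = - νδ p k

B : ℕ → ℕ → ℤ
B p k = if does (ν-pow-trivial? p k (suc p / 3)) then - (+ 2) else + 1

-- all tuples (σ_p)_{p ∈ ps}, as lists of pairs (p , k)
tuples : List ℕ → List (List (ℕ × ℕ))
tuples []       = [ [] ]
tuples (p ∷ ps) = concatMap (λ k → map ((p , k) ∷_) (tuples ps)) (reps p)

prodℤ : List ℤ → ℤ
prodℤ = foldr ℤ._*_ (+ 1)

sumℤ : List ℤ → ℤ
sumℤ = foldr ℤ._+_ (+ 0)

tupleSign : List (ℕ × ℕ) → ℤ
tupleSign t = prodℤ (map (λ { (p , k) → rootNumber p k }) t)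

H : ℤ → ℕ → List (List (ℕ × ℕ))
H s S = filter (λ t → tupleSign t ℤ.≟ s) (tuples (primeFactors S))

Bprod : List (ℕ × ℕ) → ℤ
Bprod t = prodℤ (map (λ { (p , k) → if does (p ≟ 3) then + 1 else B p k }) t)

𝓑 : ℤ → ℕ → ℤ
𝓑 s S = sumℤ (map Bprod (H s S))

𝓑⁺ 𝓑⁻ : ℕ → ℤ
𝓑⁺ = 𝓑 (+ 1)
𝓑⁻ = 𝓑 (- (+ 1))

{-# OPTIONS --safe #-}
module Submission where

-- Expanding the sum over the component at the first prime p of the list gives
--   𝓑(s; p ∷ ps) = Σ_k B(ν_k) · 𝓑(ε(σ_{ν_k}) · s; ps),
-- k running over the representatives at p.  At p = 2 and p = 3 there is a single
-- representative, which flips resp. keeps the sign s.  For p = 2m + 1 ≡ 2 (mod 3)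
-- the representatives are k = 1, …, m, and B(ν_k) and ε(σ_{ν_k}) depend only on
-- k mod 6, with the summands over one period cancelling; so for p ≡ 2r + 1 (mod 12)
-- only the terms k ≤ r survive.  With X = 𝓑⁺ and Y = 𝓑⁻ of the remaining primes,
-- p ≡ 5 acts as (X , Y) ↦ (X + Y , X + Y) and p ≡ 11 as (X , Y) ↦ (2Y , 2X);
-- iterating these maps from (1 , 0) gives the stated values.

open import Defs
open import Data.Nat
  using (ℕ; zero; suc; _+_; _*_; _∸_; _^_; _≤_; _<_; _≤?_; _/_; _%_; NonZero; >-nonZero; nonTrivial⇒n>1; z≤n; s≤s)
open import Data.Nat.Properties
  using (_≟_; allUpTo?; <-trans; <-irrefl; ≤-trans; <⇒≤; <⇒≱; ≮⇒≥; ≤∧≢⇒<; ≤-pred; n≤1+n; m≤m+n;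
         +-suc; +-assoc; +-identityʳ; +-mono-≤; +-mono-<; *-comm; m*n≢0; suc-injective; 0≢1+n;
         m+n≤o⇒m≤o∸n; m≤o∸n⇒m+n≤o)
open import Data.Nat.DivMod using (m≡m%n+[m/n]*n; m*n/n≡m; m*[n/m]≡n; m%n<n; m∣n⇒o%n%m≡o%m)
open import Data.Nat.Divisibility
  using (_∣_; _∣?_; _∣0; divides; ∣⇒≤; ∣-trans; m∣m*n; n∣m*n; ∣1⇒≡1; ∣m+n∣m⇒∣n; ∣m∣n⇒∣m+n;
         *-monoʳ-∣; *-monoˡ-∣; *-cancelʳ-∣; m%n≡0⇒n∣m; n∣m⇒m%n≡0; m%n≡0⇔n∣m)
open import Data.Nat.GCD using (gcd; gcd-greatest)
open import Data.Nat.Primality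
  using (Prime; prime?; prime[2]; ¬prime[1]; prime⇒nonZero; prime⇒nonTrivial; prime⇒irreducible; euclidsLemma)
import Data.Nat.Tactic.RingSolver as ℕ
open import Data.Integer as ℤ using (ℤ; +_; -_; _-_; -1ℤ)
import Data.Integer.Properties as ℤ
import Data.Integer.Tactic.RingSolver as ℤ
open import Data.List using (List; []; _∷_; _++_; length; map; concat; filter; upTo; applyUpTo)
open import Data.List.Properties using (map-++; map-∘; map-cong; map-applyUpTo; filter-++)
open import Data.List.Membership.Propositional using (_∈_; lose)
open import Data.List.Membership.Propositional.Properties
  using (∈-filter⁺; ∈-filter⁻; ∈-upTo⁺; ∈-upTo⁻; ∈-applyUpTo⁺; ∈-applyUpTo⁻)
open import Data.List.Relation.Unary.Any using (Any; here; there)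
open import Data.List.Relation.Unary.All using (All; []; _∷_)
import Data.List.Relation.Unary.All as All
open import Data.List.Relation.Unary.AllPairs using (AllPairs; []; _∷_)
import Data.List.Relation.Unary.AllPairs.Properties as AllPairs
open import Data.Product using (_×_; _,_; proj₂; ∃-syntax)
open import Data.Bool using (true; false; if_then_else_)
open import Data.Sum using (_⊎_; inj₁; inj₂)
open import Function using (_⇔_; mk⇔; Equivalence; id; _∘_)
open import Relation.Nullary using (¬_; yes; no; does; contradiction)
open import Relation.Nullary.Decidable
  using (_×-dec_; _⊎-dec_; _→-dec_; ¬?; dec-false; does-⇔; toWitness; toWitnessFalse; from-yes)
open import Relation.Unary using (Pred; Decidable)
open import Relation.Binary.PropositionalEquality
  using (_≡_; _≢_; refl; sym; trans; cong; cong₂; subst; subst₂; module ≡-Reasoning)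

open Equivalence using (to; from)

∈-tail : ∀ {k y} {ys : List ℕ} → k ∈ y ∷ ys → y < k → k ∈ ys
∈-tail (here refl) y<y = contradiction y<y (<-irrefl refl)
∈-tail (there k∈ys) _  = k∈ys

strictlySorted-≡ : ∀ {xs ys : List ℕ} → AllPairs _<_ xs → AllPairs _<_ ys →
                   (∀ {k} → k ∈ xs ⇔ k ∈ ys) → xs ≡ ys
strictlySorted-≡ [] [] _ = refl
strictlySorted-≡ [] (_ ∷ _) xs⇔ys with () ← from xs⇔ys (here refl)
strictlySorted-≡ (_ ∷ _) [] xs⇔ys with () ← to xs⇔ys (here refl)
strictlySorted-≡ {x ∷ xs} {y ∷ ys} (x<xs ∷ xs↑) (y<ys ∷ ys↑) xs⇔ys =
  cong₂ _∷_ x≡y (strictlySorted-≡ xs↑ ys↑ tails⇔)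
  where
  x≡y : x ≡ y
  x≡y with to xs⇔ys (here refl) | from xs⇔ys (here refl)
  ... | here x≡y   | _          = x≡y
  ... | there _    | here y≡x   = sym y≡x
  ... | there x∈ys | there y∈xs =
    contradiction (<-trans (All.lookup x<xs y∈xs) (All.lookup y<ys x∈ys)) (<-irrefl refl)
  tails⇔ : ∀ {k} → k ∈ xs ⇔ k ∈ ys
  tails⇔ = mk⇔ (λ k∈xs → ∈-tail (to xs⇔ys (there k∈xs)) (subst (_< _) x≡y (All.lookup x<xs k∈xs)))
               (λ k∈ys → ∈-tail (from xs⇔ys (there k∈ys)) (subst (_< _) (sym x≡y) (All.lookup y<ys k∈ys)))

module _ {p} {P : Pred ℕ p} (P? : Decidable P) where

  ∈-filter-upTo : ∀ {n k} → k ∈ filter P? (upTo n) ⇔ (k < n × P k)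
  ∈-filter-upTo = mk⇔ (λ k∈ → let (k∈upTo , Pk) = ∈-filter⁻ P? k∈ in ∈-upTo⁻ k∈upTo , Pk)
                      (λ (k<n , Pk) → ∈-filter⁺ P? (∈-upTo⁺ k<n) Pk)

  filter-upTo-strictlySorted : ∀ n → AllPairs _<_ (filter P? (upTo n))
  filter-upTo-strictlySorted n = AllPairs.filter⁺ P? (AllPairs.applyUpTo⁺₁ id n (λ i<j _ → i<j))

  filter-upTo-≡ : ∀ {n xs} → AllPairs _<_ xs → (∀ {k} → k ∈ xs ⇔ (k < n × P k)) →
                  filter P? (upTo n) ≡ xs
  filter-upTo-≡ {n} xs↑ xs⇔ = strictlySorted-≡ (filter-upTo-strictlySorted n) xs↑
    (mk⇔ (λ k∈ → from xs⇔ (to ∈-filter-upTo k∈)) (λ k∈ → from ∈-filter-upTo (to xs⇔ k∈)))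

filter-map-⇔ : ∀ {a b p q} {A : Set a} {B : Set b} {P : Pred B p} {Q : Pred A q}
               (P? : Decidable P) (Q? : Decidable Q) (f : A → B) →
               (∀ x → P (f x) ⇔ Q x) → ∀ xs → filter P? (map f xs) ≡ map f (filter Q? xs)
filter-map-⇔ P? Q? f P∘f⇔Q []       = refl
filter-map-⇔ P? Q? f P∘f⇔Q (x ∷ xs) with P? (f x) | Q? x
... | yes _   | yes _  = cong (f x ∷_) (filter-map-⇔ P? Q? f P∘f⇔Q xs)
... | no _    | no _   = filter-map-⇔ P? Q? f P∘f⇔Q xs
... | yes Pfx | no ¬Qx = contradiction (to (P∘f⇔Q x) Pfx) ¬Qx
... | no ¬Pfx | yes Qx = contradiction (from (P∘f⇔Q x) Qx) ¬Pfx

applyUpTo-cong : ∀ {a} {A : Set a} {f g : ℕ → A} → (∀ i → f i ≡ g i) → ∀ n → applyUpTo f n ≡ applyUpTo g n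
applyUpTo-cong f≗g zero    = refl
applyUpTo-cong f≗g (suc n) = cong₂ _∷_ (f≗g 0) (applyUpTo-cong (f≗g ∘ suc) n)

applyUpTo-++ : ∀ {a} {A : Set a} (f : ℕ → A) m n →
               applyUpTo f (m + n) ≡ applyUpTo f m ++ applyUpTo (λ i → f (m + i)) n
applyUpTo-++ f zero    n = refl
applyUpTo-++ f (suc m) n = cong (f 0 ∷_) (applyUpTo-++ (f ∘ suc) m n)

sumℤ-++ : ∀ xs ys → sumℤ (xs ++ ys) ≡ sumℤ xs ℤ.+ sumℤ ys
sumℤ-++ []       ys = sym (ℤ.+-identityˡ (sumℤ ys))
sumℤ-++ (x ∷ xs) ys = trans (cong (ℤ._+_ x) (sumℤ-++ xs ys)) (sym (ℤ.+-assoc x (sumℤ xs) (sumℤ ys)))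

sumℤ-map-*ˡ : ∀ {a} {A : Set a} c (f : A → ℤ) xs → sumℤ (map (λ x → c ℤ.* f x) xs) ≡ c ℤ.* sumℤ (map f xs)
sumℤ-map-*ˡ c f []       = sym (ℤ.*-zeroʳ c)
sumℤ-map-*ˡ c f (x ∷ xs) = trans (cong (ℤ._+_ (c ℤ.* f x)) (sumℤ-map-*ˡ c f xs))
                                 (sym (ℤ.*-distribˡ-+ c (f x) (sumℤ (map f xs))))

module _ {a p} {A : Set a} {P : Pred A p} (P? : Decidable P) (g : A → ℤ) where

  sumℤ-filter-concat : ∀ xss → sumℤ (map g (filter P? (concat xss))) ≡
                               sumℤ (map (λ xs → sumℤ (map g (filter P? xs))) xss)
  sumℤ-filter-concat []         = refl
  sumℤ-filter-concat (xs ∷ xss) = begin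
    sumℤ (map g (filter P? (xs ++ concat xss)))
      ≡⟨ cong (sumℤ ∘ map g) (filter-++ P? xs (concat xss)) ⟩
    sumℤ (map g (filter P? xs ++ filter P? (concat xss)))
      ≡⟨ cong sumℤ (map-++ g (filter P? xs) (filter P? (concat xss))) ⟩
    sumℤ (map g (filter P? xs) ++ map g (filter P? (concat xss)))
      ≡⟨ sumℤ-++ (map g (filter P? xs)) (map g (filter P? (concat xss))) ⟩
    sumℤ (map g (filter P? xs)) ℤ.+ sumℤ (map g (filter P? (concat xss)))
      ≡⟨ cong (ℤ._+_ (sumℤ (map g (filter P? xs)))) (sumℤ-filter-concat xss) ⟩
    sumℤ (map g (filter P? xs)) ℤ.+ sumℤ (map (λ xs → sumℤ (map g (filter P? xs))) xss) ∎
    where open ≡-Reasoning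

module _ (d : ℕ) (h : ℕ → ℤ) (h-periodic : ∀ i → h (d + i) ≡ h i)
         (period-sum≡0 : sumℤ (applyUpTo h d) ≡ + 0) where

  sumℤ-applyUpTo-periodic : ∀ q r → sumℤ (applyUpTo h (q * d + r)) ≡ sumℤ (applyUpTo h r)
  sumℤ-applyUpTo-periodic zero    r = refl
  sumℤ-applyUpTo-periodic (suc q) r = begin
    sumℤ (applyUpTo h ((d + q * d) + r))
      ≡⟨ cong (sumℤ ∘ applyUpTo h) (+-assoc d (q * d) r) ⟩
    sumℤ (applyUpTo h (d + n))
      ≡⟨ cong sumℤ (applyUpTo-++ h d n) ⟩
    sumℤ (applyUpTo h d ++ applyUpTo (λ i → h (d + i)) n)
      ≡⟨ sumℤ-++ (applyUpTo h d) (applyUpTo (λ i → h (d + i)) n) ⟩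
    sumℤ (applyUpTo h d) ℤ.+ sumℤ (applyUpTo (λ i → h (d + i)) n)
      ≡⟨ cong₂ ℤ._+_ period-sum≡0 (cong sumℤ (applyUpTo-cong h-periodic n)) ⟩
    + 0 ℤ.+ sumℤ (applyUpTo h n)
      ≡⟨ ℤ.+-identityˡ (sumℤ (applyUpTo h n)) ⟩
    sumℤ (applyUpTo h (q * d + r))
      ≡⟨ sumℤ-applyUpTo-periodic q r ⟩
    sumℤ (applyUpTo h r) ∎
    where
    n : ℕ
    n = q * d + r
    open ≡-Reasoning

2^n+2^n≡2^[1+n] : ∀ n → + (2 ^ n) ℤ.+ + (2 ^ n) ≡ + (2 ^ suc n)
2^n+2^n≡2^[1+n] n = cong (λ x → + (2 ^ n + x)) (sym (+-identityʳ (2 ^ n)))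

4×2^n≡2^[2+n] : ∀ {X} n → X ≡ + (2 ^ n) → (X ℤ.+ X) ℤ.+ (X ℤ.+ X) ≡ + (2 ^ (2 + n))
4×2^n≡2^[2+n] n refl = trans (cong₂ ℤ._+_ (2^n+2^n≡2^[1+n] n) (2^n+2^n≡2^[1+n] n)) (2^n+2^n≡2^[1+n] (suc n))

*-involutive-⇔ : ∀ {ε x s} → ε ℤ.* ε ≡ + 1 → ε ℤ.* x ≡ s ⇔ x ≡ ε ℤ.* s
*-involutive-⇔ {ε} {x} {s} ε²≡1 = mk⇔ (λ εx≡s → trans (sym (ε*[ε*y]≡y x)) (cong (ε ℤ.*_) εx≡s))
                                       (λ x≡εs → trans (cong (ε ℤ.*_) x≡εs) (ε*[ε*y]≡y s))
  where
  ε*[ε*y]≡y : ∀ y → ε ℤ.* (ε ℤ.* y) ≡ y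
  ε*[ε*y]≡y y = trans (sym (ℤ.*-assoc ε ε y)) (trans (cong (ℤ._* y) ε²≡1) (ℤ.*-identityˡ y))

half-≤ : ∀ {i j} → i + i ≤ j + j → i ≤ j
half-≤ ii≤jj = ≮⇒≥ (λ j<i → <⇒≱ (+-mono-< j<i j<i) ii≤jj)

2m+1≢2 : ∀ m → suc (m + m) ≢ 2
2m+1≢2 (suc m) 2m+3≡2 with () ← trans (sym (+-suc m m)) (suc-injective (suc-injective 2m+3≡2))

∤⇒nonZero : ∀ {d n} → ¬ d ∣ n → NonZero n
∤⇒nonZero {d} {zero}  d∤0 = contradiction (d ∣0) d∤0
∤⇒nonZero {n = suc _} _   = _

*-cancel-∣⇔ : ∀ {d k} t .{{_ : NonZero t}} → t * d ∣ k * t ⇔ d ∣ k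
*-cancel-∣⇔ {d} {k} t = mk⇔ (λ td∣kt → *-cancelʳ-∣ t (subst (_∣ k * t) (*-comm t d) td∣kt))
                            (λ d∣k → subst (_∣ k * t) (*-comm d t) (*-monoˡ-∣ t d∣k))

prime[3] : Prime 3
prime[3] = from-yes (prime? 3)

prime⇒2≤ : ∀ {p} → Prime p → 2 ≤ p
prime⇒2≤ {p} pp = nonTrivial⇒n>1 p {{prime⇒nonTrivial pp}}

residues-mod-12 : ∀ {r} → r < 12 → r % 2 ≢ 0 → r % 3 ≢ 0 → r % 3 ≢ 1 → r ≡ 5 ⊎ r ≡ 11
residues-mod-12 = toWitness {a? = allUpTo? (λ r → ¬? (r % 2 ≟ 0) →-dec (¬? (r % 3 ≟ 0) →-dec
                                (¬? (r % 3 ≟ 1) →-dec ((r ≟ 5) ⊎-dec (r ≟ 11))))) 12} _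

Is5or11Mod12 : ℕ → Set
Is5or11Mod12 p = p % 12 ≡ 5 ⊎ p % 12 ≡ 11

coprime-to-6⇒5or11Mod12 : ∀ {S p} → gcd S 6 ≡ 1 → p ∣ S → p % 3 ≢ 1 → Is5or11Mod12 p
coprime-to-6⇒5or11Mod12 {S} {p} gcd≡1 p∣S p%3≢1 =
  residues-mod-12 (m%n<n p 12) (∤⇒≢0 2 (divides 3 refl) (λ ())) (∤⇒≢0 3 (divides 2 refl) (λ ()))
                  (p%3≢1 ∘ trans (sym (p%12%d≡p%d 3 (divides 4 refl))))
  where
  p%12%d≡p%d : ∀ d .{{_ : NonZero d}} → d ∣ 12 → p % 12 % d ≡ p % d
  p%12%d≡p%d d d∣12 = m∣n⇒o%n%m≡o%m d 12 p d∣12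
  ∤⇒≢0 : ∀ d .{{_ : NonZero d}} → d ∣ 6 → d ≢ 1 → p % 12 % d ≢ 0
  ∤⇒≢0 d d∣6 d≢1 r%d≡0 = d≢1 (∣1⇒≡1 (subst (d ∣_) gcd≡1 (gcd-greatest (∣-trans d∣p p∣S) d∣6)))
    where
    d∣p : d ∣ p
    d∣p = m%n≡0⇒n∣m p d (trans (sym (p%12%d≡p%d d (∣-trans d∣6 (divides 2 refl)))) r%d≡0)

primeDivisor? : ∀ S → Decidable (λ k → Prime k × k ∣ S)
primeDivisor? S k = prime? k ×-dec k ∣? S

primeFactors-strictlySorted : ∀ S → AllPairs _<_ (primeFactors S)
primeFactors-strictlySorted S = filter-upTo-strictlySorted (primeDivisor? S) (suc S)

module _ {S} .{{_ : NonZero S}} where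

  ∈-primeFactors : ∀ {k} → k ∈ primeFactors S ⇔ (Prime k × k ∣ S)
  ∈-primeFactors = mk⇔ (λ k∈ → proj₂ (to (∈-filter-upTo (primeDivisor? S) {suc S}) k∈))
                       (λ (pk , k∣S) → from (∈-filter-upTo (primeDivisor? S) {suc S}) (s≤s (∣⇒≤ k∣S) , pk , k∣S))

  All-primeFactors : ∀ {p} {P : Pred ℕ p} → (∀ {k} → Prime k → k ∣ S → P k) → All P (primeFactors S)
  All-primeFactors P-holds = All.tabulate (λ k∈ → let (pk , k∣S) = to ∈-primeFactors k∈ in P-holds pk k∣S)

  primeFactors-≡ : ∀ {xs} → AllPairs _<_ xs → (∀ {k} → k ∈ xs ⇔ (Prime k × k ∣ S)) →
                   primeFactors S ≡ xs
  primeFactors-≡ xs↑ xs⇔ = filter-upTo-≡ (primeDivisor? S) xs↑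
    (mk⇔ (λ k∈ → let (pk , k∣S) = to xs⇔ k∈ in s≤s (∣⇒≤ k∣S) , pk , k∣S)
         (λ (_ , k∈S) → from xs⇔ k∈S))

primeFactors-∷ : ∀ {d T} → Prime d → ¬ d ∣ T → (∀ {k} → Prime k → k ∣ d * T → d ≤ k) →
                 primeFactors (d * T) ≡ d ∷ primeFactors T
primeFactors-∷ {d} {T} pd d∤T d-least =
  primeFactors-≡ (All.tabulate d<k ∷ primeFactors-strictlySorted T) (mk⇔ to′ from′)
  where
  instance
    _ : NonZero d
    _ = prime⇒nonZero pd
    _ : NonZero T
    _ = ∤⇒nonZero d∤T
    _ : NonZero (d * T)
    _ = m*n≢0 d T
  d<k : ∀ {k} → k ∈ primeFactors T → d < k
  d<k k∈ = let (pk , k∣T) = to (∈-primeFactors {T}) k∈ in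
    ≤∧≢⇒< (d-least pk (∣-trans k∣T (n∣m*n d))) (λ { refl → d∤T k∣T })
  to′ : ∀ {k} → k ∈ d ∷ primeFactors T → Prime k × k ∣ d * T
  to′ (here refl) = pd , m∣m*n T
  to′ (there k∈)  = let (pk , k∣T) = to (∈-primeFactors {T}) k∈ in pk , ∣-trans k∣T (n∣m*n d)
  from′ : ∀ {k} → Prime k × k ∣ d * T → k ∈ d ∷ primeFactors T
  from′ (pk , k∣dT) with euclidsLemma d T pk k∣dT
  ... | inj₂ k∣T = there (from (∈-primeFactors {T}) (pk , k∣T))
  ... | inj₁ k∣d with prime⇒irreducible pd k∣d
  ...   | inj₁ refl = contradiction pk ¬prime[1]
  ...   | inj₂ k≡d  = here k≡d

primeFactors-/ : ∀ {d S} .{{_ : NonZero d}} → Prime d → d ∣ S → ¬ (d * d ∣ S) →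
                 (∀ {k} → Prime k → k ∣ S → d ≤ k) → primeFactors S ≡ d ∷ primeFactors (S / d)
primeFactors-/ {d} {S} pd d∣S d²∤S d-least =
  subst (λ n → primeFactors n ≡ d ∷ primeFactors (S / d)) d*[S/d]≡S
        (primeFactors-∷ pd (λ d∣S/d → d²∤S (subst (d * d ∣_) d*[S/d]≡S (*-monoʳ-∣ d d∣S/d)))
                           (λ pk k∣S → d-least pk (subst (_ ∣_) d*[S/d]≡S k∣S)))
  where
  d*[S/d]≡S : d * (S / d) ≡ S
  d*[S/d]≡S = m*[n/m]≡n d∣S

representative? : ∀ p → Decidable (λ k → ¬ (suc p ∣ k * (p ∸ 1)) × k ≤ suc p ∸ k)
representative? p k = ¬? (ν-pow-trivial? p k (p ∸ 1)) ×-dec (k ≤? (suc p ∸ k))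

-- With p = 2m + 1, k ≤ p + 1 - k means k ≤ m + 1, and for such k
-- 2m + 2 ∣ 2mk iff 2m + 2 ∣ 2k iff k ∈ {0, m + 1}.
reps-odd : ∀ m → reps (suc (m + m)) ≡ applyUpTo suc m
reps-odd m = filter-upTo-≡ (representative? (suc (m + m)))
  (AllPairs.applyUpTo⁺₁ suc m (λ i<j _ → s≤s i<j)) (mk⇔ to′ from′)
  where
  N : ℕ
  N = suc (suc (m + m))
  N∣2mk⇒N∣2k : ∀ {k} → N ∣ k * (m + m) → N ∣ k + k
  N∣2mk⇒N∣2k {k} = ∣m+n∣m⇒∣n (subst (N ∣_) (k*N≡2mk+2k k m) (n∣m*n k))
    where
    k*N≡2mk+2k : ∀ k m → k * suc (suc (m + m)) ≡ k * (m + m) + (k + k)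
    k*N≡2mk+2k = ℕ.solve-∀
  to′ : ∀ {k} → k ∈ applyUpTo suc m → k < N × ¬ (N ∣ k * (m + m)) × k ≤ N ∸ k
  to′ k∈ with i , i<m , refl ← ∈-applyUpTo⁻ suc k∈ =
    s≤s (s≤s (≤-trans (<⇒≤ i<m) (m≤m+n m m))) ,
    (λ N∣2mk → <⇒≱ 2m<N (≤-trans (∣⇒≤ (N∣2mk⇒N∣2k N∣2mk)) 2k≤2m)) ,
    m+n≤o⇒m≤o∸n (suc i) (≤-trans 2k≤2m (<⇒≤ 2m<N))
    where
    2k≤2m : suc i + suc i ≤ m + m
    2k≤2m = +-mono-≤ i<m i<m
    2m<N : m + m < N
    2m<N = s≤s (n≤1+n (m + m))
  from′ : ∀ {k} → k < N × ¬ (N ∣ k * (m + m)) × k ≤ N ∸ k → k ∈ applyUpTo suc m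
  from′ {zero}  (_ , N∤0 , _) = contradiction (N ∣0) N∤0
  from′ {suc i} (k<N , N∤2mk , k≤N∸k) =
    ∈-applyUpTo⁺ suc (≤∧≢⇒< (≤-pred (half-≤ 2k≤2[m+1])) λ { refl → N∤2mk (divides m ([m+1]*2m≡m*N m)) })
    where
    2k≤2[m+1] : suc i + suc i ≤ suc m + suc m
    2k≤2[m+1] = subst (suc i + suc i ≤_) (cong suc (sym (+-suc m m))) (m≤o∸n⇒m+n≤o (suc i) (<⇒≤ k<N) k≤N∸k)
    [m+1]*2m≡m*N : ∀ m → suc m * (m + m) ≡ m * suc (suc (m + m))
    [m+1]*2m≡m*N = ℕ.solve-∀

hasSign? : ∀ s → Decidable (λ t → tupleSign t ≡ s)
hasSign? s t = tupleSign t ℤ.≟ s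

𝓑-primes : ℤ → List ℕ → ℤ
𝓑-primes s ps = sumℤ (map Bprod (filter (hasSign? s) (tuples ps)))

Bfactor : ℕ → ℕ → ℤ
Bfactor p k = if does (p ≟ 3) then + 1 else B p k

rootNumber²≡1 : ∀ p k → rootNumber p k ℤ.* rootNumber p k ≡ + 1
rootNumber²≡1 p k with does (p ≟ 2) | does (k % 2 ≟ 0)
... | true  | _     = refl
... | false | true  = refl
... | false | false = refl

𝓑-prefix : ∀ s p k ts →
           sumℤ (map Bprod (filter (hasSign? s) (map ((p , k) ∷_) ts))) ≡
           Bfactor p k ℤ.* sumℤ (map Bprod (filter (hasSign? (rootNumber p k ℤ.* s)) ts))
𝓑-prefix s p k ts = begin
  sumℤ (map Bprod (filter (hasSign? s) (map ((p , k) ∷_) ts)))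
    ≡⟨ cong (sumℤ ∘ map Bprod) (filter-map-⇔ (hasSign? s) (hasSign? (rootNumber p k ℤ.* s)) ((p , k) ∷_)
                                  (λ _ → *-involutive-⇔ {rootNumber p k} (rootNumber²≡1 p k)) ts) ⟩
  sumℤ (map Bprod (map ((p , k) ∷_) ts′))
    ≡⟨ cong sumℤ (sym (map-∘ ts′)) ⟩
  sumℤ (map (λ t → Bfactor p k ℤ.* Bprod t) ts′)
    ≡⟨ sumℤ-map-*ˡ (Bfactor p k) Bprod ts′ ⟩
  Bfactor p k ℤ.* sumℤ (map Bprod ts′) ∎
  where
  ts′ : List (List (ℕ × ℕ))
  ts′ = filter (hasSign? (rootNumber p k ℤ.* s)) ts
  open ≡-Reasoning

𝓑-primes-∷ : ∀ s p ps → 𝓑-primes s (p ∷ ps) ≡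
             sumℤ (map (λ k → Bfactor p k ℤ.* 𝓑-primes (rootNumber p k ℤ.* s) ps) (reps p))
𝓑-primes-∷ s p ps = begin
  𝓑-primes s (p ∷ ps)
    ≡⟨ sumℤ-filter-concat (hasSign? s) Bprod (map prefixed (reps p)) ⟩
  sumℤ (map (λ ts → sumℤ (map Bprod (filter (hasSign? s) ts))) (map prefixed (reps p)))
    ≡⟨ cong sumℤ (sym (map-∘ (reps p))) ⟩
  sumℤ (map (λ k → sumℤ (map Bprod (filter (hasSign? s) (prefixed k)))) (reps p))
    ≡⟨ cong sumℤ (map-cong (λ k → 𝓑-prefix s p k (tuples ps)) (reps p)) ⟩
  sumℤ (map (λ k → Bfactor p k ℤ.* 𝓑-primes (rootNumber p k ℤ.* s) ps) (reps p)) ∎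
  where
  prefixed : ℕ → List (List (ℕ × ℕ))
  prefixed k = map ((p , k) ∷_) (tuples ps)
  open ≡-Reasoning

B′ ε′ : ℕ → ℤ
B′ k = if does (k % 3 ≟ 0) then - (+ 2) else + 1
ε′ k = - (if does (k % 2 ≟ 0) then + 1 else - (+ 1))

Bfactor≡B′ : ∀ {p} → p ≢ 3 → 3 ∣ suc p → ∀ k → Bfactor p k ≡ B′ k
Bfactor≡B′ {p} p≢3 (divides (suc t) p+1≡[t+1]*3) k rewrite dec-false (p ≟ 3) p≢3 =
  cong (if_then - (+ 2) else + 1) (does-⇔ ord∣⇔3∣k (suc p ∣? (k * (suc p / 3))) (k % 3 ≟ 0))
  where
  [p+1]/3≡t+1 : suc p / 3 ≡ suc t
  [p+1]/3≡t+1 = trans (cong (_/ 3) p+1≡[t+1]*3) (m*n/n≡m (suc t) 3)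
  ord∣⇔3∣k : suc p ∣ k * (suc p / 3) ⇔ k % 3 ≡ 0
  ord∣⇔3∣k = mk⇔
    (λ ord∣ → from (m%n≡0⇔n∣m k 3) (to (*-cancel-∣⇔ (suc t))
                (subst₂ (λ a b → a ∣ k * b) p+1≡[t+1]*3 [p+1]/3≡t+1 ord∣)))
    (λ k%3≡0 → subst₂ (λ a b → a ∣ k * b) (sym p+1≡[t+1]*3) (sym [p+1]/3≡t+1)
                 (from (*-cancel-∣⇔ (suc t)) (to (m%n≡0⇔n∣m k 3) k%3≡0)))

rootNumber≡ε′ : ∀ {p} → p ≢ 2 → ∀ k → rootNumber p k ≡ ε′ k
rootNumber≡ε′ {p} p≢2 k rewrite dec-false (p ≟ 2) p≢2 = refl

oddTerm : ℤ → List ℕ → ℕ → ℤ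
oddTerm s ps k = B′ k ℤ.* 𝓑-primes (ε′ k ℤ.* s) ps

𝓑-primes-odd∷ : ∀ s m ps → 3 ∣ suc (suc (m + m)) →
                𝓑-primes s (suc (m + m) ∷ ps) ≡ sumℤ (applyUpTo (oddTerm s ps ∘ suc) m)
𝓑-primes-odd∷ s m ps 3∣p+1 = begin
  𝓑-primes s (p ∷ ps)
    ≡⟨ 𝓑-primes-∷ s p ps ⟩
  sumℤ (map term (reps p))
    ≡⟨ cong (sumℤ ∘ map term) (reps-odd m) ⟩
  sumℤ (map term (applyUpTo suc m))
    ≡⟨ cong sumℤ (map-cong term≡oddTerm (applyUpTo suc m)) ⟩
  sumℤ (map (oddTerm s ps) (applyUpTo suc m))
    ≡⟨ cong sumℤ (map-applyUpTo suc (oddTerm s ps) m) ⟩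
  sumℤ (applyUpTo (oddTerm s ps ∘ suc) m) ∎
  where
  p : ℕ
  p = suc (m + m)
  term : ℕ → ℤ
  term k = Bfactor p k ℤ.* 𝓑-primes (rootNumber p k ℤ.* s) ps
  p≢3 : p ≢ 3
  p≢3 p≡3 = toWitnessFalse {a? = 3 ∣? 4} _ (subst (λ q → 3 ∣ suc q) p≡3 3∣p+1)
  term≡oddTerm : ∀ k → term k ≡ oddTerm s ps k
  term≡oddTerm k = cong₂ (λ b ε → b ℤ.* 𝓑-primes (ε ℤ.* s) ps)
                         (Bfactor≡B′ p≢3 3∣p+1 k) (rootNumber≡ε′ (2m+1≢2 m) k)
  open ≡-Reasoning

-- For k = 1, …, 6 the terms are A, B, -2A, B, A, -2B, where A = 𝓑(s) and B = 𝓑(-s).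
oddTerm-period-sum : ∀ s ps → sumℤ (applyUpTo (oddTerm s ps ∘ suc) 6) ≡ + 0
oddTerm-period-sum s ps = vanishes (𝓑-primes (+ 1 ℤ.* s) ps) (𝓑-primes (-1ℤ ℤ.* s) ps)
  where
  vanishes : ∀ A B → + 1 ℤ.* A ℤ.+ (+ 1 ℤ.* B ℤ.+ (- (+ 2) ℤ.* A ℤ.+
                     (+ 1 ℤ.* B ℤ.+ (+ 1 ℤ.* A ℤ.+ (- (+ 2) ℤ.* B ℤ.+ + 0))))) ≡ + 0
  vanishes = ℤ.solve-∀

𝓑-primes-odd∷-mod12 : ∀ s p r ps → p % 12 ≡ suc (r + r) → 3 ∣ suc (suc (r + r)) →
                      𝓑-primes s (p ∷ ps) ≡ sumℤ (applyUpTo (oddTerm s ps ∘ suc) r)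
𝓑-primes-odd∷-mod12 s p r ps p%12≡2r+1 3∣2r+2 = begin
  𝓑-primes s (p ∷ ps)
    ≡⟨ cong (λ q → 𝓑-primes s (q ∷ ps)) p≡2m+1 ⟩
  𝓑-primes s (suc (m + m) ∷ ps)
    ≡⟨ 𝓑-primes-odd∷ s m ps 3∣2m+2 ⟩
  sumℤ (applyUpTo (oddTerm s ps ∘ suc) (j * 6 + r))
    ≡⟨ sumℤ-applyUpTo-periodic 6 (oddTerm s ps ∘ suc) (λ _ → refl) (oddTerm-period-sum s ps) j r ⟩
  sumℤ (applyUpTo (oddTerm s ps ∘ suc) r) ∎
  where
  j m : ℕ
  j = p / 12
  m = j * 6 + r
  2m≡2r+12j : ∀ j r → (j * 6 + r) + (j * 6 + r) ≡ (r + r) + j * 12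
  2m≡2r+12j = ℕ.solve-∀
  p≡2m+1 : p ≡ suc (m + m)
  p≡2m+1 = trans (m≡m%n+[m/n]*n p 12) (trans (cong (_+ j * 12) p%12≡2r+1) (cong suc (sym (2m≡2r+12j j r))))
  3∣2m+2 : 3 ∣ suc (suc (m + m))
  3∣2m+2 = subst (λ n → 3 ∣ suc (suc n)) (sym (2m≡2r+12j j r))
                 (∣m∣n⇒∣m+n 3∣2r+2 (∣-trans (divides 4 refl) (n∣m*n j)))
  open ≡-Reasoning

module _ (s : ℤ) (ps : List ℕ) where

  private
    A≡ : 𝓑-primes (+ 1 ℤ.* s) ps ≡ 𝓑-primes s ps
    A≡ = cong (λ s → 𝓑-primes s ps) (ℤ.*-identityˡ s)
    B≡ : 𝓑-primes (-1ℤ ℤ.* s) ps ≡ 𝓑-primes (- s) ps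
    B≡ = cong (λ s → 𝓑-primes s ps) (ℤ.-1*i≡-i s)

  𝓑-primes-5∷ : ∀ p → p % 12 ≡ 5 → 𝓑-primes s (p ∷ ps) ≡ 𝓑-primes s ps ℤ.+ 𝓑-primes (- s) ps
  𝓑-primes-5∷ p p%12≡5 = begin
    𝓑-primes s (p ∷ ps)
      ≡⟨ 𝓑-primes-odd∷-mod12 s p 2 ps p%12≡5 (divides 2 refl) ⟩
    sumℤ (applyUpTo (oddTerm s ps ∘ suc) 2)
      ≡⟨ first-two (𝓑-primes (+ 1 ℤ.* s) ps) (𝓑-primes (-1ℤ ℤ.* s) ps) ⟩
    𝓑-primes (+ 1 ℤ.* s) ps ℤ.+ 𝓑-primes (-1ℤ ℤ.* s) ps
      ≡⟨ cong₂ ℤ._+_ A≡ B≡ ⟩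
    𝓑-primes s ps ℤ.+ 𝓑-primes (- s) ps ∎
    where
    first-two : ∀ A B → + 1 ℤ.* A ℤ.+ (+ 1 ℤ.* B ℤ.+ + 0) ≡ A ℤ.+ B
    first-two = ℤ.solve-∀
    open ≡-Reasoning

  𝓑-primes-11∷ : ∀ p → p % 12 ≡ 11 → 𝓑-primes s (p ∷ ps) ≡ 𝓑-primes (- s) ps ℤ.+ 𝓑-primes (- s) ps
  𝓑-primes-11∷ p p%12≡11 = begin
    𝓑-primes s (p ∷ ps)
      ≡⟨ 𝓑-primes-odd∷-mod12 s p 5 ps p%12≡11 (divides 4 refl) ⟩
    sumℤ (applyUpTo (oddTerm s ps ∘ suc) 5)
      ≡⟨ first-five (𝓑-primes (+ 1 ℤ.* s) ps) (𝓑-primes (-1ℤ ℤ.* s) ps) ⟩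
    𝓑-primes (-1ℤ ℤ.* s) ps ℤ.+ 𝓑-primes (-1ℤ ℤ.* s) ps
      ≡⟨ cong₂ ℤ._+_ B≡ B≡ ⟩
    𝓑-primes (- s) ps ℤ.+ 𝓑-primes (- s) ps ∎
    where
    first-five : ∀ A B → + 1 ℤ.* A ℤ.+ (+ 1 ℤ.* B ℤ.+ (- (+ 2) ℤ.* A ℤ.+
                         (+ 1 ℤ.* B ℤ.+ (+ 1 ℤ.* A ℤ.+ + 0)))) ≡ B ℤ.+ B
    first-five = ℤ.solve-∀
    open ≡-Reasoning

  𝓑-primes-2∷ : 𝓑-primes s (2 ∷ ps) ≡ 𝓑-primes (- s) ps
  𝓑-primes-2∷ = trans (𝓑-primes-∷ s 2 ps) (trans (ℤ.+-identityʳ _) (trans (ℤ.*-identityˡ _) B≡))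

  𝓑-primes-3∷ : 𝓑-primes s (3 ∷ ps) ≡ 𝓑-primes s ps
  𝓑-primes-3∷ = trans (𝓑-primes-∷ s 3 ps) (trans (ℤ.+-identityʳ _) (trans (ℤ.*-identityˡ _) A≡))

𝓑-primes-11∷11∷ : ∀ s p q ps → p % 12 ≡ 11 → q % 12 ≡ 11 →
                  𝓑-primes s (p ∷ q ∷ ps) ≡
                  (𝓑-primes s ps ℤ.+ 𝓑-primes s ps) ℤ.+ (𝓑-primes s ps ℤ.+ 𝓑-primes s ps)
𝓑-primes-11∷11∷ s p q ps p%12≡11 q%12≡11 = begin
  𝓑-primes s (p ∷ q ∷ ps)
    ≡⟨ 𝓑-primes-11∷ s (q ∷ ps) p p%12≡11 ⟩
  𝓑-primes (- s) (q ∷ ps) ℤ.+ 𝓑-primes (- s) (q ∷ ps)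
    ≡⟨ cong₂ ℤ._+_ double double ⟩
  (𝓑-primes s ps ℤ.+ 𝓑-primes s ps) ℤ.+ (𝓑-primes s ps ℤ.+ 𝓑-primes s ps) ∎
  where
  double : 𝓑-primes (- s) (q ∷ ps) ≡ 𝓑-primes s ps ℤ.+ 𝓑-primes s ps
  double = trans (𝓑-primes-11∷ (- s) ps q q%12≡11)
                 (cong (λ s → 𝓑-primes s ps ℤ.+ 𝓑-primes s ps) (ℤ.neg-involutive s))
  open ≡-Reasoning

𝓑-primes-total : ∀ {ps} → All Is5or11Mod12 ps → 𝓑-primes (+ 1) ps ℤ.+ 𝓑-primes -1ℤ ps ≡ + (2 ^ length ps)
𝓑-primes-total [] = refl
𝓑-primes-total {p ∷ ps} (p-class ∷ ps-classes) = begin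
  𝓑-primes (+ 1) (p ∷ ps) ℤ.+ 𝓑-primes -1ℤ (p ∷ ps)
    ≡⟨ step p-class ⟩
  (X ℤ.+ Y) ℤ.+ (X ℤ.+ Y)
    ≡⟨ cong₂ ℤ._+_ (𝓑-primes-total ps-classes) (𝓑-primes-total ps-classes) ⟩
  + (2 ^ length ps) ℤ.+ + (2 ^ length ps)
    ≡⟨ 2^n+2^n≡2^[1+n] (length ps) ⟩
  + (2 ^ length (p ∷ ps)) ∎
  where
  X Y : ℤ
  X = 𝓑-primes (+ 1) ps
  Y = 𝓑-primes -1ℤ ps
  step : Is5or11Mod12 p → 𝓑-primes (+ 1) (p ∷ ps) ℤ.+ 𝓑-primes -1ℤ (p ∷ ps) ≡ (X ℤ.+ Y) ℤ.+ (X ℤ.+ Y)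
  step (inj₁ p%12≡5)  = trans (cong₂ ℤ._+_ (𝓑-primes-5∷ (+ 1) ps p p%12≡5) (𝓑-primes-5∷ -1ℤ ps p p%12≡5))
                              (cong (ℤ._+_ (X ℤ.+ Y)) (ℤ.+-comm Y X))
  step (inj₂ p%12≡11) = trans (cong₂ ℤ._+_ (𝓑-primes-11∷ (+ 1) ps p p%12≡11) (𝓑-primes-11∷ -1ℤ ps p p%12≡11))
                              (swap X Y)
    where
    swap : ∀ X Y → (Y ℤ.+ Y) ℤ.+ (X ℤ.+ X) ≡ (X ℤ.+ Y) ℤ.+ (X ℤ.+ Y)
    swap = ℤ.solve-∀
  open ≡-Reasoning

𝓑-primes-5∷-balanced : ∀ p {ps} → p % 12 ≡ 5 → All Is5or11Mod12 ps →
  𝓑-primes (+ 1) (p ∷ ps) ≡ + (2 ^ length ps) × 𝓑-primes -1ℤ (p ∷ ps) ≡ + (2 ^ length ps)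
𝓑-primes-5∷-balanced p {ps} p%12≡5 ps-classes =
  trans (𝓑-primes-5∷ (+ 1) ps p p%12≡5) (𝓑-primes-total ps-classes) ,
  trans (𝓑-primes-5∷ -1ℤ ps p p%12≡5)
        (trans (ℤ.+-comm (𝓑-primes -1ℤ ps) (𝓑-primes (+ 1) ps)) (𝓑-primes-total ps-classes))

𝓑-primes-with-5 : ∀ {ps} → All Is5or11Mod12 ps → Any (λ p → p % 12 ≡ 5) ps →
  𝓑-primes (+ 1) ps ≡ + (2 ^ (length ps ∸ 1)) × 𝓑-primes -1ℤ ps ≡ + (2 ^ (length ps ∸ 1))
𝓑-primes-with-5 {p ∷ _} (_ ∷ classes) (here p%12≡5) = 𝓑-primes-5∷-balanced p p%12≡5 classes
𝓑-primes-with-5 {p ∷ _} (inj₁ p%12≡5 ∷ classes) (there _) = 𝓑-primes-5∷-balanced p p%12≡5 classes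
𝓑-primes-with-5 (inj₂ _ ∷ []) (there ())
𝓑-primes-with-5 {p ∷ q ∷ qs} (inj₂ p%12≡11 ∷ classes) (there has-5)
  with X≡ , Y≡ ← 𝓑-primes-with-5 classes has-5 =
  trans (𝓑-primes-11∷ (+ 1) (q ∷ qs) p p%12≡11) (trans (cong₂ ℤ._+_ Y≡ Y≡) (2^n+2^n≡2^[1+n] (length qs))) ,
  trans (𝓑-primes-11∷ -1ℤ (q ∷ qs) p p%12≡11) (trans (cong₂ ℤ._+_ X≡ X≡) (2^n+2^n≡2^[1+n] (length qs)))

𝓑-primes-all-11-even : ∀ {ps} → All (λ p → p % 12 ≡ 11) ps → length ps % 2 ≡ 0 →
  𝓑-primes (+ 1) ps ≡ + (2 ^ length ps) × 𝓑-primes -1ℤ ps ≡ + 0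
𝓑-primes-all-11-even [] _ = refl , refl
𝓑-primes-all-11-even {p ∷ q ∷ qs} (p%12≡11 ∷ q%12≡11 ∷ all-11) even
  with X≡ , Y≡ ← 𝓑-primes-all-11-even all-11 even =
  trans (𝓑-primes-11∷11∷ (+ 1) p q qs p%12≡11 q%12≡11) (4×2^n≡2^[2+n] (length qs) X≡) ,
  trans (𝓑-primes-11∷11∷ -1ℤ p q qs p%12≡11 q%12≡11) (cong (λ Y → (Y ℤ.+ Y) ℤ.+ (Y ℤ.+ Y)) Y≡)

𝓑-primes-all-11-odd : ∀ {ps} → All (λ p → p % 12 ≡ 11) ps → length ps % 2 ≡ 1 →
  𝓑-primes (+ 1) ps ≡ + 0 × 𝓑-primes -1ℤ ps ≡ + (2 ^ length ps)
𝓑-primes-all-11-odd {p ∷ []} (p%12≡11 ∷ []) _ =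
  𝓑-primes-11∷ (+ 1) [] p p%12≡11 , 𝓑-primes-11∷ -1ℤ [] p p%12≡11
𝓑-primes-all-11-odd {p ∷ q ∷ qs} (p%12≡11 ∷ q%12≡11 ∷ all-11) odd
  with X≡ , Y≡ ← 𝓑-primes-all-11-odd all-11 odd =
  trans (𝓑-primes-11∷11∷ (+ 1) p q qs p%12≡11 q%12≡11) (cong (λ X → (X ℤ.+ X) ℤ.+ (X ℤ.+ X)) X≡) ,
  trans (𝓑-primes-11∷11∷ -1ℤ p q qs p%12≡11 q%12≡11) (4×2^n≡2^[2+n] (length qs) Y≡)

𝓑-odd-3∣ : ∀ s {S} → SquareFree S → S % 2 ≡ 1 → 3 ∣ S → 𝓑 s S ≡ 𝓑 s (S / 3)
𝓑-odd-3∣ s {S} squarefree S-odd 3∣S =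
  trans (cong (𝓑-primes s) S=3·S/3) (𝓑-primes-3∷ s (primeFactors (S / 3)))
  where
  S=3·S/3 : primeFactors S ≡ 3 ∷ primeFactors (S / 3)
  S=3·S/3 = primeFactors-/ prime[3] 3∣S (squarefree 3 prime[3])
    (λ pk k∣S → ≤∧≢⇒< (prime⇒2≤ pk) (λ { refl → 0≢1+n (trans (sym (n∣m⇒m%n≡0 S 2 k∣S)) S-odd) }))

𝓑-even : ∀ s {S} → SquareFree S → S % 2 ≡ 0 → 𝓑 s S ≡ 𝓑 (- s) (S / 2)
𝓑-even s {S} squarefree S-even =
  trans (cong (𝓑-primes s) S=2·S/2) (𝓑-primes-2∷ s (primeFactors (S / 2)))
  where
  S=2·S/2 : primeFactors S ≡ 2 ∷ primeFactors (S / 2)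
  S=2·S/2 = primeFactors-/ prime[2] (m%n≡0⇒n∣m S 2 S-even) (squarefree 2 prime[2]) (λ pk _ → prime⇒2≤ pk)

-- The hypotheses 3 < S and 2 < S are unused: the recursions also hold for S = 3 and S = 2.
lemma7p4 : (S : ℕ) → 1 < S → SquareFree S → D3≡1 S →
    ( gcd S 6 ≡ 1 →
        ( ((∃[ p ] (Prime p × p ∣ S × p % 12 ≡ 5)) →
             (𝓑⁺ S ≡ + (2 ^ (ω S ∸ 1))) × (𝓑⁻ S ≡ + (2 ^ (ω S ∸ 1))))
        × ((∀ p → Prime p → p ∣ S → p % 12 ≡ 11) → ω S % 2 ≡ 0 →
             (𝓑⁺ S ≡ + (2 ^ ω S)) × (𝓑⁻ S ≡ + 0))
        × ((∀ p → Prime p → p ∣ S → p % 12 ≡ 11) → ω S % 2 ≡ 1 →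
             (𝓑⁺ S ≡ + 0) × (𝓑⁻ S ≡ + (2 ^ ω S)))
        × (𝓑⁻ S ≡ + (2 ^ ω S) - 𝓑⁺ S) ) )
    × ( S % 2 ≡ 1 → 3 ∣ S → 3 < S →
          (𝓑⁺ S ≡ 𝓑⁺ (S / 3)) × (𝓑⁻ S ≡ 𝓑⁻ (S / 3)) )
    × ( 𝓑⁺ 3 ≡ + 1 ) × ( 𝓑⁻ 3 ≡ + 0 )
    × ( S % 2 ≡ 0 → 2 < S →
          (𝓑⁺ S ≡ 𝓑⁻ (S / 2)) × (𝓑⁻ S ≡ 𝓑⁺ (S / 2)) )
    × ( 𝓑⁺ 2 ≡ + 0 ) × ( 𝓑⁻ 2 ≡ + 1 )
lemma7p4 S 1<S squarefree D₃≡1 =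
  (λ gcd≡1 →
    (λ (p , pp , p∣S , p%12≡5) →
       𝓑-primes-with-5 (classes gcd≡1) (lose (from ∈-primeFactors (pp , p∣S)) p%12≡5)) ,
    (λ all-11 → 𝓑-primes-all-11-even (All-primeFactors (all-11 _))) ,
    (λ all-11 → 𝓑-primes-all-11-odd (All-primeFactors (all-11 _))) ,
    trans (y≡[x+y]-x (𝓑⁺ S) (𝓑⁻ S)) (cong (_- 𝓑⁺ S) (𝓑-primes-total (classes gcd≡1)))) ,
  (λ S-odd 3∣S _ → 𝓑-odd-3∣ (+ 1) squarefree S-odd 3∣S , 𝓑-odd-3∣ -1ℤ squarefree S-odd 3∣S) ,
  refl , refl ,
  (λ S-even _ → 𝓑-even (+ 1) squarefree S-even , 𝓑-even -1ℤ squarefree S-even) ,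
  refl , refl
  where
  instance
    _ : NonZero S
    _ = >-nonZero (<-trans (s≤s z≤n) 1<S)
  classes : gcd S 6 ≡ 1 → All Is5or11Mod12 (primeFactors S)
  classes gcd≡1 = All-primeFactors (λ pp p∣S → coprime-to-6⇒5or11Mod12 gcd≡1 p∣S (D₃≡1 _ pp p∣S))
  y≡[x+y]-x : ∀ x y → y ≡ (x ℤ.+ y) - x
  y≡[x+y]-x = ℤ.solve-∀
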